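{- Let $(G=(V,E),w,k)$ be an instance of the Min-WED problem such that $0\le\min\{\min\{w(x)\mid x\in V\},k\}$. Let $M=\max\{\sum_{x\in V}w(x),k\}+1$, let $w'(x)=M\cdot|N_G[x]|-w(x)$ for all $x\in V$, and let $k'=M\cdot|V|-k$. Then $(G,w,k)$ is a yes-instance of Min-WED if and only if $(G^2,w',k')$ is a yes-instance of the MWIS problem.
   Context: All graphs are finite, simple and undirected. $N_G[x]$ denotes the closed neighborhood of $x$ in $G$ (the set consisting of $x$ and its neighbors); a vertex dominates itself and its neighbors. An efficient dominating set of $G=(V,E)$ is a set $D\subseteq V$ such that every vertex of $V$ is dominated by exactly one vertex of $D$. The square $G^2=(V,E^2)$ has $uv\in E^2$ iff $u\neq v$ and either $uv\in E$ or $u,v$ have a common neighbor in $G$. For $w:V\to\mathbb{Z}$ and $S\subseteq V$, $w(S)=\sum_{x\in S}w(x)$. Min-WED: given a graph $G=(V,E)$, weights $w:V\to\mathbb{Z}$ and an integer $k$, decide whether $G$ has an efficient dominating set $D$ with $w(D)\le k$. MWIS: given a graph $H$, weights $w:V(H)\to\mathbb{Z}$ and an integer $k$, decide whether $H$ has an independent set $I$ with $w(I)\ge k$. -}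

module Defs where

open import Data.Nat using (ℕ; zero; suc)
open import Data.Fin using (Fin; zero; suc; _≟_)
open import Data.Bool using (Bool; true; false; _∨_; _∧_; not; if_then_else_)
open import Data.Integer using (ℤ; +_; _+_; _-_; _*_; _≤_; _⊔_)
open import Data.Product using (Σ; _×_; ∃-syntax)
open import Relation.Nullary using (¬_; ⌊_⌋)
open import Relation.Binary.PropositionalEquality using (_≡_)

record Graph : Set where
  field
    n   : ℕ
    adj : Fin n → Fin n → Bool
open Graph public

Vertex : Graph → Set
Vertex G = Fin (n G)

IsSimple : Graph → Set
IsSimple G = (∀ u v → adj G u v ≡ adj G v u) × (∀ u → adj G u u ≡ false)

Σℤ : {m : ℕ} → (Fin m → ℤ) → ℤ
Σℤ {zero}  f = + 0
Σℤ {suc m} f = f zero + Σℤ (λ i → f (suc i))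

anyFin : {m : ℕ} → (Fin m → Bool) → Bool
anyFin {zero}  f = false
anyFin {suc m} f = f zero ∨ anyFin (λ i → f (suc i))

VSet : Graph → Set
VSet G = Vertex G → Bool

_∈ₛ_ : {m : ℕ} → Fin m → (Fin m → Bool) → Set
x ∈ₛ S = S x ≡ true

weight : (G : Graph) → (Vertex G → ℤ) → VSet G → ℤ
weight G w S = Σℤ (λ x → if S x then w x else + 0)

N[_]_ : (G : Graph) → Vertex G → VSet G
N[ G ] x = λ y → ⌊ x ≟ y ⌋ ∨ adj G x y

card : (G : Graph) → VSet G → ℤ
card G S = weight G (λ _ → + 1) S

IsEfficientDominating : (G : Graph) → VSet G → Set
IsEfficientDominating G D =
  ∀ (y : Vertex G) →
    (∃[ x ] (x ∈ₛ D × y ∈ₛ (N[ G ] x))) ×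
    (∀ x x′ → x ∈ₛ D → y ∈ₛ (N[ G ] x) → x′ ∈ₛ D → y ∈ₛ (N[ G ] x′) → x ≡ x′)

Square : Graph → Graph
Square G = record
  { n = n G
  ; adj = λ u v → not ⌊ u ≟ v ⌋ ∧ (adj G u v ∨ anyFin (λ z → adj G u z ∧ adj G z v)) }

IsIndependent : (H : Graph) → VSet H → Set
IsIndependent H I = ∀ u v → u ∈ₛ I → v ∈ₛ I → ¬ (adj H u v ≡ true)

MinWED-yes : (G : Graph) → (Vertex G → ℤ) → ℤ → Set
MinWED-yes G w k = ∃[ D ] (IsEfficientDominating G D × weight G w D ≤ k)

MWIS-yes : (H : Graph) → (Vertex H → ℤ) → ℤ → Set
MWIS-yes H w k = ∃[ I ] (IsIndependent H I × k ≤ weight H w I)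

bigM : (G : Graph) → (Vertex G → ℤ) → ℤ → ℤ
bigM G w k = (Σℤ w ⊔ k) + + 1

w′ : (G : Graph) → (Vertex G → ℤ) → ℤ → Vertex G → ℤ
w′ G w k x = bigM G w k * card G (N[ G ] x) - w x

k′ : (G : Graph) → (Vertex G → ℤ) → ℤ → ℤ
k′ G w k = bigM G w k * + (n G) - k

-- Write T for the number of pairs (x, y) with x ∈ S and y ∈ N[x]. Then w′(S) = M·T − w(S).
-- S is independent in G² exactly when the closed neighbourhoods of its vertices are pairwise
-- disjoint (a packing), and then T ≤ |V|, with equality iff S also dominates G, i.e. iff S is
-- an efficient dominating set. For an efficient dominating set the bound w′(S) ≥ k′ is
-- equivalent to w(S) ≤ k. For a packing that misses a vertex, T ≤ |V| − 1 and so
-- w′(S) ≤ M·|V| − M < M·|V| − k = k′, because w(S) ≥ 0 and M > k.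
module Submission where

open import Defs
open import Data.Integer using (ℤ; +_; _≤_)
open import Data.Product using (_×_)
open import Function.Bundles using (_⇔_)

open import Algebra.Properties.CommutativeSemigroup as CommSemigroupProperties using ()
open import Data.Bool using (Bool; true; false; _∧_; _∨_; if_then_else_)
open import Data.Bool.Properties using (∧-conicalˡ; ∧-conicalʳ; ∨-zeroʳ)
import Data.Bool.Properties as Bool
open import Data.Empty using (⊥-elim)
open import Data.Fin using (Fin; zero; suc; _≟_)
open import Data.Fin.Properties using (0≢1+n; suc-injective; any?; all?; ¬∀⟶∃¬)
open import Data.Integer using (_+_; _-_; _*_; -_; _<_; +≤+; +<+; 0ℤ; 1ℤ; nonNegative)
open import Data.Integer.Properties hiding (_≟_)
open import Data.Integer.Tactic.RingSolver using (solve-∀)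
open import Data.Nat using (zero; suc; z≤n; s≤s)
open import Data.Product using (∃-syntax; _,_; proj₁; proj₂)
open import Data.Sum using (_⊎_; inj₁; inj₂)
open import Function.Base using (_∘_; case_of_)
open import Function.Bundles using (mk⇔; Equivalence)
open import Relation.Binary.PropositionalEquality
open import Relation.Nullary using (¬_; yes; no; ⌊_⌋)
open import Relation.Nullary.Decidable using (_×-dec_)
open import Relation.Unary using (Decidable)

open CommSemigroupProperties +-commutativeSemigroup using (interchange)

Σℤ-cong : ∀ {m} {f g : Fin m → ℤ} → (∀ i → f i ≡ g i) → Σℤ f ≡ Σℤ g
Σℤ-cong {zero}  _   = refl
Σℤ-cong {suc m} f≗g = cong₂ _+_ (f≗g zero) (Σℤ-cong (f≗g ∘ suc))

Σℤ-zero : ∀ m → Σℤ {m} (λ _ → 0ℤ) ≡ 0ℤ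
Σℤ-zero zero    = refl
Σℤ-zero (suc m) = cong (_+_ 0ℤ) (Σℤ-zero m)

Σℤ-one : ∀ m → Σℤ {m} (λ _ → 1ℤ) ≡ + m
Σℤ-one zero    = refl
Σℤ-one (suc m) = cong (_+_ 1ℤ) (Σℤ-one m)

Σℤ-distrib-+ : ∀ {m} (f g : Fin m → ℤ) → Σℤ (λ i → f i + g i) ≡ Σℤ f + Σℤ g
Σℤ-distrib-+ {zero}  f g = refl
Σℤ-distrib-+ {suc m} f g =
  trans (cong (_+_ (f zero + g zero)) (Σℤ-distrib-+ (f ∘ suc) (g ∘ suc)))
        (interchange (f zero) (g zero) (Σℤ (f ∘ suc)) (Σℤ (g ∘ suc)))

Σℤ-distribˡ-* : ∀ {m} c (f : Fin m → ℤ) → Σℤ (λ i → c * f i) ≡ c * Σℤ f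
Σℤ-distribˡ-* {zero}  c f = sym (*-zeroʳ c)
Σℤ-distribˡ-* {suc m} c f =
  trans (cong (_+_ (c * f zero)) (Σℤ-distribˡ-* c (f ∘ suc)))
        (sym (*-distribˡ-+ c (f zero) (Σℤ (f ∘ suc))))

Σℤ-neg : ∀ {m} (f : Fin m → ℤ) → Σℤ (λ i → - f i) ≡ - Σℤ f
Σℤ-neg {zero}  f = refl
Σℤ-neg {suc m} f =
  trans (cong (_+_ (- f zero)) (Σℤ-neg (f ∘ suc)))
        (sym (neg-distrib-+ (f zero) (Σℤ (f ∘ suc))))

Σℤ-comm : ∀ {m p} (f : Fin m → Fin p → ℤ) →
          Σℤ (λ i → Σℤ (f i)) ≡ Σℤ (λ j → Σℤ (λ i → f i j))
Σℤ-comm {zero}  {p} f = sym (Σℤ-zero p)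
Σℤ-comm {suc m}     f =
  trans (cong (_+_ (Σℤ (f zero))) (Σℤ-comm (f ∘ suc)))
        (sym (Σℤ-distrib-+ (f zero) (λ j → Σℤ (λ i → f (suc i) j))))

Σℤ-mono-≤ : ∀ {m} {f g : Fin m → ℤ} → (∀ i → f i ≤ g i) → Σℤ f ≤ Σℤ g
Σℤ-mono-≤ {zero}  _   = ≤-refl
Σℤ-mono-≤ {suc m} f≤g = +-mono-≤ (f≤g zero) (Σℤ-mono-≤ (f≤g ∘ suc))

Σℤ-mono-< : ∀ {m} {f g : Fin m → ℤ} → (∀ i → f i ≤ g i) → ∀ j → f j < g j → Σℤ f < Σℤ g
Σℤ-mono-< f≤g zero    fj<gj = +-mono-<-≤ fj<gj (Σℤ-mono-≤ (f≤g ∘ suc))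
Σℤ-mono-< f≤g (suc j) fj<gj = +-mono-≤-< (f≤g zero) (Σℤ-mono-< (f≤g ∘ suc) j fj<gj)

indicator : Bool → ℤ
indicator b = if b then 1ℤ else 0ℤ

0≤indicator : ∀ b → 0ℤ ≤ indicator b
0≤indicator true  = +≤+ z≤n
0≤indicator false = +≤+ z≤n

-- card G S is definitionally count S.
count : ∀ {m} → (Fin m → Bool) → ℤ
count P = Σℤ (indicator ∘ P)

count-≡-0 : ∀ {m} (P : Fin m → Bool) → (∀ i → ¬ i ∈ₛ P) → count P ≡ 0ℤ
count-≡-0 {m} P ∉P = trans (Σℤ-cong indicator≡0) (Σℤ-zero m)
  where
  indicator≡0 : ∀ i → indicator (P i) ≡ 0ℤ
  indicator≡0 i with P i | ∉P i
  ... | true  | i∉P = ⊥-elim (i∉P refl)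
  ... | false | _   = refl

count-≤-1 : ∀ {m} (P : Fin m → Bool) → (∀ i j → i ∈ₛ P → j ∈ₛ P → i ≡ j) → count P ≤ 1ℤ
count-≤-1 {zero}  P _      = +≤+ z≤n
count-≤-1 {suc m} P unique with P zero in 0∈P
... | true  = ≤-reflexive (cong (_+_ 1ℤ)
                (count-≡-0 (P ∘ suc) (λ i i∈P → 0≢1+n (unique zero (suc i) 0∈P i∈P))))
... | false = subst (_≤ 1ℤ) (sym (+-identityˡ _))
                (count-≤-1 (P ∘ suc) (λ i j i∈P j∈P → suc-injective (unique (suc i) (suc j) i∈P j∈P)))

0<count : ∀ {m} (P : Fin m → Bool) i → i ∈ₛ P → 0ℤ < count P
0<count {m} P i i∈P = subst (_< count P) (Σℤ-zero m) (Σℤ-mono-< (0≤indicator ∘ P) i 0<indicator)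
  where
  0<indicator : 0ℤ < indicator (P i)
  0<indicator rewrite i∈P = +<+ (s≤s z≤n)

anyFin-intro : ∀ {m} (P : Fin m → Bool) i → i ∈ₛ P → anyFin P ≡ true
anyFin-intro P zero    i∈P = cong (_∨ anyFin (P ∘ suc)) i∈P
anyFin-intro P (suc i) i∈P = trans (cong (P zero ∨_) (anyFin-intro (P ∘ suc) i i∈P)) (∨-zeroʳ (P zero))

anyFin-witness : ∀ {m} (P : Fin m → Bool) → anyFin P ≡ true → ∃[ i ] i ∈ₛ P
anyFin-witness {zero}  P ()
anyFin-witness {suc m} P h with P zero in 0∈P
... | true  = zero , 0∈P
... | false with anyFin-witness (P ∘ suc) h
...   | i , i∈P = suc i , i∈P

a*t-w<a*n-k : ∀ {a t n w k} → 0ℤ ≤ w → 0ℤ ≤ k → k < a → t < n → a * t - w < a * n - k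
a*t-w<a*n-k {a} {t} {n} {w} {k} 0≤w 0≤k k<a t<n = begin-strict
  a * t - w          ≤⟨ i-j≤i (a * t) w ⦃ nonNegative 0≤w ⦄ ⟩
  a * t              ≡⟨ shift a t ⟩
  (a + a * t) - a    ≡⟨ cong (_- a) (sym (*-suc a t)) ⟩
  a * (1ℤ + t) - a   ≤⟨ +-monoˡ-≤ (- a) (*-monoˡ-≤-nonNeg a ⦃ nonNegative 0≤a ⦄ (i<j⇒suc[i]≤j t<n)) ⟩
  a * n - a          <⟨ +-monoʳ-< (a * n) (neg-mono-< k<a) ⟩
  a * n - k          ∎
  where
  open ≤-Reasoning
  0≤a : 0ℤ ≤ a
  0≤a = <⇒≤ (≤-<-trans 0≤k k<a)
  shift : ∀ a t → a * t ≡ (a + a * t) - a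
  shift = solve-∀

a-v≤a-w⇒w≤v : ∀ a {v w} → a - v ≤ a - w → w ≤ v
a-v≤a-w⇒w≤v a h = ≮⇒≥ (λ v<w → ≤⇒≯ h (+-monoʳ-< a (neg-mono-< v<w)))

module _ (G : Graph) where

  weight-nonNeg : ∀ {w} → (∀ x → 0ℤ ≤ w x) → ∀ S → 0ℤ ≤ weight G w S
  weight-nonNeg {w} 0≤w S = subst (_≤ weight G w S) (Σℤ-zero (n G)) (Σℤ-mono-≤ 0≤restriction)
    where
    0≤restriction : ∀ x → 0ℤ ≤ (if S x then w x else 0ℤ)
    0≤restriction x with S x
    ... | true  = 0≤w x
    ... | false = ≤-refl

  weight-linear : ∀ c f g S → weight G (λ x → c * f x - g x) S ≡ c * weight G f S - weight G g S
  weight-linear c f g S = begin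
    weight G (λ x → c * f x - g x) S          ≡⟨ Σℤ-cong restriction-linear ⟩
    Σℤ (λ x → c * F x + - H x)                ≡⟨ Σℤ-distrib-+ (λ x → c * F x) (λ x → - H x) ⟩
    Σℤ (λ x → c * F x) + Σℤ (λ x → - H x)     ≡⟨ cong₂ _+_ (Σℤ-distribˡ-* c F) (Σℤ-neg H) ⟩
    c * weight G f S - weight G g S           ∎
    where
    open ≡-Reasoning
    F H : Vertex G → ℤ
    F x = if S x then f x else 0ℤ
    H x = if S x then g x else 0ℤ
    restriction-linear : ∀ x → (if S x then c * f x - g x else 0ℤ) ≡ c * F x + - H x
    restriction-linear x with S x
    ... | true  = refl
    ... | false = cong (_+ 0ℤ) (sym (*-zeroʳ c))

  dominators : VSet G → Vertex G → VSet G
  dominators S y x = S x ∧ (N[ G ] x) y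

  domination : VSet G → Vertex G → ℤ
  domination S y = count (dominators S y)

  weight-card-N≡Σ-domination : ∀ S → weight G (λ x → card G (N[ G ] x)) S ≡ Σℤ (domination S)
  weight-card-N≡Σ-domination S =
    trans (Σℤ-cong row) (Σℤ-comm (λ x y → indicator (S x ∧ (N[ G ] x) y)))
    where
    row : ∀ x → (if S x then card G (N[ G ] x) else 0ℤ) ≡ count (λ y → S x ∧ (N[ G ] x) y)
    row x with S x
    ... | true  = refl
    ... | false = sym (Σℤ-zero (n G))

  Dominated : VSet G → Vertex G → Set
  Dominated S y = ∃[ x ] (x ∈ₛ S × y ∈ₛ (N[ G ] x))

  dominated? : ∀ S → Decidable (Dominated S)
  dominated? S y = any? (λ x → (S x Bool.≟ true) ×-dec ((N[ G ] x) y Bool.≟ true))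

  Packing : VSet G → Set
  Packing S = ∀ y x x′ → x ∈ₛ S → y ∈ₛ (N[ G ] x) → x′ ∈ₛ S → y ∈ₛ (N[ G ] x′) → x ≡ x′

  domination-≤-1 : ∀ {S} → Packing S → ∀ y → domination S y ≤ 1ℤ
  domination-≤-1 packing y = count-≤-1 _ λ x x′ x∈ x′∈ →
    packing y x x′ (∧-conicalˡ _ _ x∈) (∧-conicalʳ _ _ x∈) (∧-conicalˡ _ _ x′∈) (∧-conicalʳ _ _ x′∈)

  domination-≡-0 : ∀ {S y} → ¬ Dominated S y → domination S y ≡ 0ℤ
  domination-≡-0 undominated = count-≡-0 _ λ x x∈ →
    undominated (x , ∧-conicalˡ _ _ x∈ , ∧-conicalʳ _ _ x∈)

  domination-≡-1 : ∀ {S y} → Packing S → Dominated S y → domination S y ≡ 1ℤ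
  domination-≡-1 {y = y} packing (x , x∈S , y∈N[x]) =
    ≤-antisym (domination-≤-1 packing y) (i<j⇒suc[i]≤j (0<count _ x (cong₂ _∧_ x∈S y∈N[x])))

  Σ-domination-≡-n : ∀ {S} → Packing S → (∀ y → Dominated S y) → Σℤ (domination S) ≡ + n G
  Σ-domination-≡-n packing dominating =
    trans (Σℤ-cong (λ y → domination-≡-1 packing (dominating y))) (Σℤ-one (n G))

  Σ-domination-<-n : ∀ {S} y → Packing S → ¬ Dominated S y → Σℤ (domination S) < + n G
  Σ-domination-<-n {S} y packing undominated =
    subst (Σℤ (domination S) <_) (Σℤ-one (n G))
      (Σℤ-mono-< (domination-≤-1 packing) y
        (subst (_< 1ℤ) (sym (domination-≡-0 undominated)) (+<+ (s≤s z≤n))))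

  N-self : ∀ x → x ∈ₛ (N[ G ] x)
  N-self x with x ≟ x
  ... | yes _   = refl
  ... | no  x≢x = ⊥-elim (x≢x refl)

  N-adj : ∀ {x y} → adj G x y ≡ true → y ∈ₛ (N[ G ] x)
  N-adj {x} {y} xy = trans (cong (⌊ x ≟ y ⌋ ∨_) xy) (∨-zeroʳ _)

  N-cases : ∀ {x y} → y ∈ₛ (N[ G ] x) → x ≡ y ⊎ adj G x y ≡ true
  N-cases {x} {y} y∈N[x] with x ≟ y
  ... | yes x≡y = inj₁ x≡y
  ... | no  _   = inj₂ y∈N[x]

  Square-irreflexive : ∀ x → adj (Square G) x x ≡ false
  Square-irreflexive x with x ≟ x
  ... | yes _   = refl
  ... | no  x≢x = ⊥-elim (x≢x refl)

  Square-adj⇒≢ : ∀ {x x′} → adj (Square G) x x′ ≡ true → ¬ x ≡ x′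
  Square-adj⇒≢ {x} x~x refl = case trans (sym x~x) (Square-irreflexive x) of λ ()

  Square-adj-≢ : ∀ {x x′} → ¬ x ≡ x′ →
                 adj (Square G) x x′ ≡ (adj G x x′ ∨ anyFin (λ z → adj G x z ∧ adj G z x′))
  Square-adj-≢ {x} {x′} x≢x′ with x ≟ x′
  ... | yes x≡x′ = ⊥-elim (x≢x′ x≡x′)
  ... | no  _    = refl

module _ (G : Graph) (adj-sym : ∀ u v → adj G u v ≡ adj G v u) where

  N-meet⇔Square-adj : ∀ {x x′} → ¬ x ≡ x′ →
                      (∃[ y ] (y ∈ₛ (N[ G ] x) × y ∈ₛ (N[ G ] x′))) ⇔ adj (Square G) x x′ ≡ true
  N-meet⇔Square-adj {x} {x′} x≢x′ = mk⇔
    (λ (y , y∈N[x] , y∈N[x′]) → trans (Square-adj-≢ G x≢x′) (meet (N-cases G y∈N[x]) (N-cases G y∈N[x′])))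
    (λ x~x′ → apart (trans (sym (Square-adj-≢ G x≢x′)) x~x′))
    where
    CommonNeighbour Within2 : Bool
    CommonNeighbour = anyFin (λ z → adj G x z ∧ adj G z x′)
    Within2 = adj G x x′ ∨ CommonNeighbour
    meet : ∀ {y} → x ≡ y ⊎ adj G x y ≡ true → x′ ≡ y ⊎ adj G x′ y ≡ true → Within2 ≡ true
    meet (inj₁ refl) (inj₁ refl) = ⊥-elim (x≢x′ refl)
    meet (inj₁ refl) (inj₂ x′y)  = cong (_∨ CommonNeighbour) (trans (adj-sym x x′) x′y)
    meet (inj₂ xy)   (inj₁ refl) = cong (_∨ CommonNeighbour) xy
    meet {y} (inj₂ xy) (inj₂ x′y) =
      trans (cong (adj G x x′ ∨_) (anyFin-intro _ y (cong₂ _∧_ xy (trans (adj-sym y x′) x′y))))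
            (∨-zeroʳ _)
    apart : Within2 ≡ true → ∃[ y ] (y ∈ₛ (N[ G ] x) × y ∈ₛ (N[ G ] x′))
    apart within2 with adj G x x′ in xx′
    ... | true  = x′ , N-adj G xx′ , N-self G x′
    ... | false with anyFin-witness _ within2
    ...   | z , xzx′ = z , N-adj G (∧-conicalˡ _ _ xzx′) , N-adj G (trans (adj-sym x′ z) (∧-conicalʳ _ _ xzx′))

  Packing⇔Square-independent : ∀ S → Packing G S ⇔ IsIndependent (Square G) S
  Packing⇔Square-independent S = mk⇔ independent packing
    where
    independent : Packing G S → IsIndependent (Square G) S
    independent disjoint u v u∈S v∈S u~v
      with Equivalence.from (N-meet⇔Square-adj (Square-adj⇒≢ G u~v)) u~v
    ... | y , y∈N[u] , y∈N[v] = Square-adj⇒≢ G u~v (disjoint y u v u∈S y∈N[u] v∈S y∈N[v])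
    packing : IsIndependent (Square G) S → Packing G S
    packing indep y x x′ x∈S y∈N[x] x′∈S y∈N[x′] with x ≟ x′
    ... | yes x≡x′ = x≡x′
    ... | no  x≢x′ = ⊥-elim (indep x x′ x∈S x′∈S (Equivalence.to (N-meet⇔Square-adj x≢x′) (y , y∈N[x] , y∈N[x′])))

k<bigM : ∀ G w k → k < bigM G w k
k<bigM G w k = suc[i]≤j⇒i<j (subst (_≤ bigM G w k) (+-comm k 1ℤ) (+-monoˡ-≤ 1ℤ (i≤j⊔i (Σℤ w) k)))

weight-w′ : ∀ G w k S → weight G (w′ G w k) S ≡ bigM G w k * Σℤ (domination G S) - weight G w S
weight-w′ G w k S =
  trans (weight-linear G (bigM G w k) (λ x → card G (N[ G ] x)) w S)
        (cong (λ t → bigM G w k * t - weight G w S) (weight-card-N≡Σ-domination G S))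

weight-w′-efficient : ∀ G w k {S} → Packing G S → (∀ y → Dominated G S y) →
                      weight G (w′ G w k) S ≡ bigM G w k * + n G - weight G w S
weight-w′-efficient G w k {S} packing dominating =
  trans (weight-w′ G w k S) (cong (λ t → bigM G w k * t - weight G w S) (Σ-domination-≡-n G packing dominating))

lemma2 : (G : Graph) → IsSimple G → (w : Vertex G → ℤ) → (k : ℤ) →
         (∀ x → + 0 ≤ w x) → + 0 ≤ k →
         MinWED-yes G w k ⇔ MWIS-yes (Square G) (w′ G w k) (k′ G w k)
lemma2 G (adj-sym , _) w k 0≤w 0≤k = mk⇔ to from
  where
  Mn : ℤ
  Mn = bigM G w k * + n G
  to : MinWED-yes G w k → MWIS-yes (Square G) (w′ G w k) (k′ G w k)
  to (D , efficient , wD≤k) =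
    D , Equivalence.to (Packing⇔Square-independent G adj-sym D) packing ,
    subst (k′ G w k ≤_) (sym (weight-w′-efficient G w k packing (proj₁ ∘ efficient)))
      (+-monoʳ-≤ Mn (neg-mono-≤ wD≤k))
    where
    packing : Packing G D
    packing = proj₂ ∘ efficient
  from : MWIS-yes (Square G) (w′ G w k) (k′ G w k) → MinWED-yes G w k
  from (I , independent , k′≤w′I)
    with Equivalence.from (Packing⇔Square-independent G adj-sym I) independent | all? (dominated? G I)
  ... | packing | yes dominating =
    I , (λ y → dominating y , packing y) ,
    a-v≤a-w⇒w≤v Mn (subst (k′ G w k ≤_) (weight-w′-efficient G w k packing dominating) k′≤w′I)
  ... | packing | no ¬dominating with ¬∀⟶∃¬ (n G) _ (dominated? G I) ¬dominating
  ...   | y , undominated = ⊥-elim (<⇒≱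
          (a*t-w<a*n-k (weight-nonNeg G 0≤w I) 0≤k (k<bigM G w k) (Σ-domination-<-n G y packing undominated))
          (subst (k′ G w k ≤_) (weight-w′ G w k I) k′≤w′I))
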